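{- Let $a<b$ be coprime positive integers, let $D$ be an $a,b$-Dyck path and $\pi=\pi(D)\in\mathsf{NC}(a,b)$, with rank sequence $R(\pi)=(r_1,\dots,r_{b-1})$. Then: (1) for every block $B$ of $\pi$, the vertical run of $D$ visible from $B$ (the maximal run of north steps of $D$ lying on the line $x=\min(B)-1$) has exactly $\mathrm{rank}^{\pi}_{a,b}(B)$ north steps; (2) $D=N^{r_1}EN^{r_2}E\cdots N^{r_{b-1}}EE$.
   Context: Let $a<b$ be coprime positive integers and $[b-1]=\{1,\dots,b-1\}$. An $a,b$-Dyck path is a lattice path from $(0,0)$ to $(b,a)$ using unit north ($N$) and east ($E$) steps that stays weakly above the line $y=\frac{a}{b}x$. A valley of such a path $D$ is a lattice point of $D$ immediately preceded by an east step and immediately followed by a north step. From each valley $P$ fire the laser $\ell(P)$: the segment of slope $\frac ab$ from $P$ going northeast until it first meets $D$ again. Label the east endpoints of the first $b-1$ east steps of $D$ from left to right by $1,\dots,b-1$, each label regarded as sitting slightly below its lattice point. The set partition $\pi(D)$ of $[b-1]$ declares $i\sim j$ iff labels $i,j$ are not separated by any valley laser. $\mathsf{NC}(a,b)=\{\pi(D)\}$. Rank: for a noncrossing partition $\pi$ of $[b-1]$, order its blocks by $B'\preceq B$ iff $[\min B',\max B']\subseteq[\min B,\max B]$; the integers $\mathrm{rank}^{\pi}_{a,b}(B)$ are the unique integers with $\sum_{B'\preceq B}\mathrm{rank}^{\pi}_{a,b}(B')=\lceil(\max B-\min B+1)\frac ab\rceil$ for all blocks $B$. The rank sequence of $\pi\in\mathsf{NC}(a,b)$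 is $R(\pi)=(r_1,\dots,r_{b-1})$ where $r_i=\mathrm{rank}^{\pi}_{a,b}(B)$ if $i=\min(B)$ for some block $B$, and $r_i=0$ otherwise. (Under the labeling, $\min(B)$ labels the lattice point immediately to the right of the vertical run visible from $B$.) -}

module Defs where

open import Data.Nat using (ℕ; zero; suc; _+_; _*_; _∸_; _≤_; _<_; _/_; _<ᵇ_; _≤ᵇ_; _≡ᵇ_)
open import Data.Bool using (Bool; true; false; _∧_; _∨_; not; if_then_else_)
open import Data.List using (List; []; _∷_; _++_; take; drop; replicate; map; foldr; upTo; length)
open import Data.Nat.ListAction using (sum)
open import Data.Bool.ListAction using (all; any)
open import Data.Integer as ℤ using (ℤ; +_)
open import Data.Product using (_×_; _,_)
open import Relation.Binary.PropositionalEquality using (_≡_)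

data Step : Set where
  N E : Step

countN : List Step → ℕ
countN []      = 0
countN (N ∷ s) = suc (countN s)
countN (E ∷ s) = countN s

countE : List Step → ℕ
countE []      = 0
countE (N ∷ s) = countE s
countE (E ∷ s) = suc (countE s)

pt : List Step → ℕ → ℕ × ℕ
pt D t = countE (take t D) , countN (take t D)

-- a,b-Dyck path: from (0,0) to (b,a) with N/E unit steps, every lattice
-- point (x,y) of the path satisfies y ≥ (a/b) x, i.e. a*x ≤ b*y.
IsDyck : ℕ → ℕ → List Step → Set
IsDyck a b D =
  countN D ≡ a × countE D ≡ b ×
  (∀ t → a * countE (take t D) ≤ b * countN (take t D))

-- number of north steps of D lying on the vertical line x = c
-- (the maximal vertical run of D on that line; possibly empty)
runLen : List Step → ℕ → ℕ
runLen []      c       = 0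
runLen (N ∷ D) zero    = suc (runLen D zero)
runLen (N ∷ D) (suc c) = runLen D (suc c)
runLen (E ∷ D) zero    = 0
runLen (E ∷ D) (suc c) = runLen D c

-- y-coordinate of the east endpoint of the k-th east step (k ≥ 1);
-- label k sits (slightly below) the lattice point (k , eastY D k).
eastY : List Step → ℕ → ℕ
eastY D k = sum (map (runLen D) (upTo k))

-- [lo+1 .. hi] as a list
range : ℕ → ℕ → List ℕ
range lo hi = map (λ i → lo + suc i) (upTo (hi ∸ lo))

-- the point after t steps (t ≥ 1) is a valley: step t is E and step t+1 is N
isValleyAt : List Step → Bool
isValleyAt (E ∷ N ∷ _) = true
isValleyAt _           = false

isValley : List Step → ℕ → Bool
isValley D zero    = false
isValley D (suc t) = isValleyAt (drop t D)

-- Label i (at (i , eastY D i) minus ε) lies in the region enclosed by the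
-- laser ℓ(P) from the valley P = (px,py) and the path D.
-- With φ(x,y) = b*y − a*x, the laser is the level set φ = φ(P); it runs
-- northeast from P with D above it until D first crosses it, which happens
-- (as lasers meet no lattice point other than P) in the interior of the
-- first east step k > px whose east endpoint has φ < φ(P).  Hence the label
-- i is enclosed iff px < i and every east endpoint (k , eastY D k) with
-- px < k ≤ i lies strictly above the laser line.
-- "strictly above": b*y − a*x > b*py − a*px, written without subtraction.
aboveLaser : ℕ → ℕ → ℕ × ℕ → ℕ → ℕ → Bool
aboveLaser a b (px , py) x y = (b * py + a * x) <ᵇ (b * y + a * px)

enclosed : ℕ → ℕ → List Step → ℕ × ℕ → ℕ → Bool
enclosed a b D (px , py) i =
  (px <ᵇ i) ∧ all (λ k → aboveLaser a b (px , py) k (eastY D k)) (range px i)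

sameSide : ℕ → ℕ → List Step → ℕ → ℕ → ℕ → Bool
sameSide a b D i j t =
  not (isValley D t) ∨ (enclosed a b D (pt D t) i ≡ᵇb enclosed a b D (pt D t) j)
  where
  _≡ᵇb_ : Bool → Bool → Bool
  true  ≡ᵇb y = y
  false ≡ᵇb y = not y

sim : ℕ → ℕ → List Step → ℕ → ℕ → Bool
sim a b D i j = all (sameSide a b D i j) (range 0 (length D))

isMin : ℕ → ℕ → List Step → ℕ → Bool
isMin a b D m = not (any (λ j → sim a b D m j) (range 0 (m ∸ 1)))

max' : ℕ → ℕ → ℕ
max' m n = if m ≤ᵇ n then n else m

blkMax : ℕ → ℕ → List Step → ℕ → ℕ
blkMax a b D m =
  foldr max' m (map (λ j → if sim a b D m j then j else 0) (range 0 (b ∸ 1)))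

ceilDiv : ℕ → ℕ → ℕ
ceilDiv x zero    = 0
ceilDiv x (suc k) = (x + k) / suc k

precBlk : ℕ → ℕ → List Step → ℕ → ℕ → Bool
precBlk a b D m' m = isMin a b D m' ∧ (m ≤ᵇ m') ∧ (blkMax a b D m' ≤ᵇ blkMax a b D m)

sumℤ : List ℤ → ℤ
sumℤ = foldr ℤ._+_ (+ 0)

-- rk (indexed by block minima) solves the defining system of rank^π_{a,b}:
-- Σ_{B' ⪯ B} rk(B') = ⌈(max B − min B + 1) a / b⌉ for every block B of π(D).
IsRank : ℕ → ℕ → List Step → (ℕ → ℤ) → Set
IsRank a b D rk =
  ∀ m → 1 ≤ m → m < b → isMin a b D m ≡ true →
    sumℤ (map (λ m' → if precBlk a b D m' m then rk m' else + 0) (range 0 (b ∸ 1)))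
      ≡ + ceilDiv ((blkMax a b D m ∸ m + 1) * a) b

rankSeq : ℕ → ℕ → List Step → (ℕ → ℤ) → ℕ → ℤ
rankSeq a b D rk i = if isMin a b D i then rk i else + 0

word : List ℕ → List Step
word []       = E ∷ []
word (r ∷ rs) = replicate r N ++ (E ∷ word rs)

{-# OPTIONS --safe #-}
module Submission where

-- With φ(x , y) = b·y − a·x, the laser from a valley P is the level set of φ through P; write
-- h(k) = φ(k , y_k) for the point carrying label k. Two labels share a block iff they have the same
-- innermost enclosing laser, so p + 1 is a block minimum iff p = 0 or the vertical run on x = p is
-- nonempty (then (p , y_p) is a valley). For the block with minimum p + 1 and maximum M one shows
-- h(p) ≤ h(M) ≤ h(p) + a, the upper bound by walking right from M until the path drops below the laser
-- from p; as a < b this forces y_M − y_p = ⌈(M − p)a/b⌉. That rise is the sum of the runs on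
-- x = p, …, M − 1, and each nonempty one among them is the run of a block nested in this one, so the
-- run lengths solve the defining system of the ranks. The system is triangular for nesting, hence each
-- rank is the length of its run; the runs on x = b − 1 and x = b are empty, and the others spell D.

open import Defs
open import Data.Bool using (Bool; true; false; if_then_else_)
import Data.Bool.Properties as Bool
open import Data.Bool.Properties using (T-≡; T-not-≡; T-∧; not-¬; ¬-not)
open import Data.Bool.ListAction using (all; any)
open import Data.Empty using (⊥-elim)
open import Data.Integer as ℤ using (ℤ; +_; ∣_∣; +≤+; +<+)
import Data.Integer.Properties as ℤP
open import Algebra.Properties.AbelianGroup ℤP.+-0-abelianGroup
  using () renaming (∙-cancelˡ to +-cancelˡ; ∙-cancelʳ to +-cancelʳ)
open import Data.Integer.Tactic.RingSolver using (solve-∀)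
import Data.Nat.Tactic.RingSolver as ℕRing
open import Data.List using (List; []; _∷_; _++_; _∷ʳ_; map; foldr; replicate; drop; length; upTo; applyUpTo)
import Data.List.Properties as LP
open import Data.List.Membership.Propositional using (_∈_; find; lose)
open import Data.List.Membership.Propositional.Properties using (∈-map⁺; ∈-map⁻; ∈-upTo⁺; ∈-upTo⁻)
import Data.List.Relation.Unary.All as All
open import Data.List.Relation.Unary.All.Properties using (all⁺; all⁻)
open import Data.List.Relation.Unary.Any using (here; there)
open import Data.List.Relation.Unary.Any.Properties using (any⁺; any⁻)
open import Data.Nat
  using (ℕ; zero; suc; _+_; _*_; _∸_; _≤_; _<_; _≤ᵇ_; _<ᵇ_; _⊔_; _⊓_; _/_; z≤n; s≤s; NonZero; >-nonZero)
open import Data.Nat.Coprimality using (Coprime)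
import Data.Nat.Properties as ℕP
import Data.Nat.DivMod as DivMod
open import Data.Nat.ListAction using (sum)
open import Data.Nat.ListAction.Properties using (sum-++)
open import Data.Product using (_×_; _,_; proj₁; proj₂; ∃-syntax; map₁; map₂)
open import Data.Sum using (_⊎_; inj₁; inj₂)
open import Function using (_∘_; _⇔_; mk⇔; Equivalence; case_of_)
open import Relation.Nullary using (¬_; Dec; yes; no)
open import Relation.Nullary.Decidable using (_×-dec_; map′)
open import Relation.Binary.Definitions using (tri<; tri≈; tri>)
open import Relation.Nullary.Reflects using (ofʸ; ofⁿ)
open import Relation.Binary.PropositionalEquality
  using (_≡_; _≢_; refl; sym; trans; cong; cong₂; subst; subst₂; module ≡-Reasoning)

-- Ranges, sums and maxima

∈-range⁻ : ∀ {lo hi k} → k ∈ range lo hi → lo < k × k ≤ hi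
∈-range⁻ {lo} {hi} k∈ with ∈-map⁻ (λ i → lo + suc i) k∈
... | i , i∈ , refl =
  ℕP.m<m+n lo (s≤s z≤n) , ℕP.≤-trans (ℕP.+-monoʳ-≤ lo i<) (ℕP.≤-reflexive (ℕP.m+[n∸m]≡n (ℕP.<⇒≤ lo<hi)))
  where
  i< = ∈-upTo⁻ i∈
  lo<hi : lo < hi
  lo<hi = ℕP.∸-cancelʳ-< (subst (_< hi ∸ lo) (sym (ℕP.n∸n≡0 hi)) (ℕP.≤-trans (s≤s z≤n) i<))

∈-range⁺ : ∀ {lo hi k} → lo < k → k ≤ hi → k ∈ range lo hi
∈-range⁺ {lo} {hi} {k} lo<k k≤hi = subst (_∈ range lo hi) k≡ (∈-map⁺ (λ i → lo + suc i) (∈-upTo⁺ i<))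
  where
  i = k ∸ suc lo
  sucᵢ : k ∸ lo ≡ suc i
  sucᵢ = ℕP.+-∸-assoc 1 lo<k
  k≡ : lo + suc i ≡ k
  k≡ = trans (cong (λ x → lo + x) (sym sucᵢ)) (ℕP.m+[n∸m]≡n (ℕP.<⇒≤ lo<k))
  i< : i < hi ∸ lo
  i< = subst (_≤ hi ∸ lo) sucᵢ (ℕP.∸-monoˡ-≤ lo k≤hi)

all≡true⁻ : ∀ {A : Set} (f : A → Bool) xs → all f xs ≡ true → ∀ {x} → x ∈ xs → f x ≡ true
all≡true⁻ f xs e x∈ = Equivalence.to T-≡ (All.lookup (all⁺ f xs (Equivalence.from T-≡ e)) x∈)

all≡true⁺ : ∀ {A : Set} (f : A → Bool) xs → (∀ {x} → x ∈ xs → f x ≡ true) → all f xs ≡ true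
all≡true⁺ f xs h = Equivalence.to T-≡ (all⁻ f (All.tabulate (Equivalence.from T-≡ ∘ h)))

any≡false⁻ : ∀ {A : Set} (f : A → Bool) xs → any f xs ≡ false → ∀ {x} → x ∈ xs → f x ≡ false
any≡false⁻ f xs e {x} x∈ with f x in fx
... | false = refl
... | true with () ← trans (sym (Equivalence.to T-≡ (any⁺ f (lose x∈ (Equivalence.from T-≡ fx))))) e

any≡false⁺ : ∀ {A : Set} (f : A → Bool) xs → (∀ {x} → x ∈ xs → f x ≡ false) → any f xs ≡ false
any≡false⁺ f xs h with any f xs in e
... | false = refl
... | true with find (any⁻ f xs (Equivalence.from T-≡ e))
...   | _ , x∈ , fx = ⊥-elim (not-¬ (h x∈) (Equivalence.to T-≡ fx))

map-cong-range : ∀ {A : Set} (f g : ℕ → A) {lo hi} → (∀ {k} → lo < k → k ≤ hi → f k ≡ g k) →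
  map f (range lo hi) ≡ map g (range lo hi)
map-cong-range f g h = LP.map-cong-local (All.tabulate (λ k∈ → let lo<k , k≤hi = ∈-range⁻ k∈ in h lo<k k≤hi))

range0-suc : ∀ n → range 0 (suc n) ≡ range 0 n ∷ʳ suc n
range0-suc n = trans (cong (map suc) (sym (LP.upTo-∷ʳ n))) (LP.map-++ suc (upTo n) (n ∷ []))

sumℤ-snoc : ∀ (F : ℕ → ℤ) xs x → sumℤ (map F (xs ∷ʳ x)) ≡ sumℤ (map F xs) ℤ.+ F x
sumℤ-snoc F [] x = trans (ℤP.+-identityʳ (F x)) (sym (ℤP.+-identityˡ (F x)))
sumℤ-snoc F (y ∷ xs) x = trans (cong (λ z → F y ℤ.+ z) (sumℤ-snoc F xs x)) (sym (ℤP.+-assoc (F y) _ (F x)))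

sumℤ-range0-suc : ∀ (F : ℕ → ℤ) n → sumℤ (map F (range 0 (suc n))) ≡ sumℤ (map F (range 0 n)) ℤ.+ F (suc n)
sumℤ-range0-suc F n = trans (cong (sumℤ ∘ map F) (range0-suc n)) (sumℤ-snoc F (range 0 n) (suc n))

sumℤ-telescope : ∀ (g F : ℕ → ℤ) n → (∀ i → i < n → g i ℤ.+ F (suc i) ≡ g (suc i)) →
  g 0 ℤ.+ sumℤ (map F (range 0 n)) ≡ g n
sumℤ-telescope g F zero step = ℤP.+-identityʳ (g 0)
sumℤ-telescope g F (suc n) step = begin
  g 0 ℤ.+ sumℤ (map F (range 0 (suc n)))      ≡⟨ cong (λ z → g 0 ℤ.+ z) (sumℤ-range0-suc F n) ⟩
  g 0 ℤ.+ (sumℤ (map F (range 0 n)) ℤ.+ F (suc n)) ≡⟨ sym (ℤP.+-assoc (g 0) _ _) ⟩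
  (g 0 ℤ.+ sumℤ (map F (range 0 n))) ℤ.+ F (suc n) ≡⟨ cong (ℤ._+ F (suc n)) (sumℤ-telescope g F n step′) ⟩
  g n ℤ.+ F (suc n)                            ≡⟨ step n (ℕP.n<1+n n) ⟩
  g (suc n)                                    ∎
  where
  open ≡-Reasoning
  step′ : ∀ i → i < n → g i ℤ.+ F (suc i) ≡ g (suc i)
  step′ i i<n = step i (ℕP.m<n⇒m<1+n i<n)

sumℤ-agree-except : ∀ (F G : ℕ → ℤ) n {m} → 0 < m → m ≤ n →
  (∀ {k} → 0 < k → k ≤ n → k ≢ m → F k ≡ G k) →
  sumℤ (map F (range 0 n)) ≡ sumℤ (map G (range 0 n)) → F m ≡ G m
sumℤ-agree-except F G zero (s≤s _) ()
sumℤ-agree-except F G (suc n) {m} 0<m m≤1+n agree sums with ℕP.m≤n⇒m<n∨m≡n m≤1+n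
... | inj₂ refl = +-cancelˡ (sumℤ (map F (range 0 n))) (F m) (G m) (begin
  sumℤ (map F (range 0 n)) ℤ.+ F m   ≡⟨ sym (sumℤ-range0-suc F n) ⟩
  sumℤ (map F (range 0 m))           ≡⟨ sums ⟩
  sumℤ (map G (range 0 m))           ≡⟨ sumℤ-range0-suc G n ⟩
  sumℤ (map G (range 0 n)) ℤ.+ G m   ≡⟨ cong (ℤ._+ G m) (sym (cong sumℤ (map-cong-range F G
                                          (λ 0<k k≤n → agree 0<k (ℕP.m≤n⇒m≤1+n k≤n) (ℕP.<⇒≢ (s≤s k≤n)))))) ⟩
  sumℤ (map F (range 0 n)) ℤ.+ G m   ∎)
  where open ≡-Reasoning
... | inj₁ m<1+n = sumℤ-agree-except F G n 0<m (ℕP.≤-pred m<1+n)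
  (λ 0<k k≤n → agree 0<k (ℕP.m≤n⇒m≤1+n k≤n))
  (+-cancelʳ (F (suc n)) _ _ (begin
    sumℤ (map F (range 0 n)) ℤ.+ F (suc n) ≡⟨ sym (sumℤ-range0-suc F n) ⟩
    sumℤ (map F (range 0 (suc n)))        ≡⟨ sums ⟩
    sumℤ (map G (range 0 (suc n)))        ≡⟨ sumℤ-range0-suc G n ⟩
    sumℤ (map G (range 0 n)) ℤ.+ G (suc n) ≡⟨ cong (λ z → sumℤ (map G (range 0 n)) ℤ.+ z)
                                                (sym (agree (s≤s z≤n) ℕP.≤-refl (ℕP.<⇒≢ m<1+n ∘ sym))) ⟩
    sumℤ (map G (range 0 n)) ℤ.+ F (suc n) ∎))
  where open ≡-Reasoning

ceilDiv-unique : ∀ {x d} b .{{_ : NonZero b}} → x ≤ b * d → b * d < x + b → ceilDiv x b ≡ d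
ceilDiv-unique {x} {d} b@(suc c) x≤bd bd<x+b = ℕP.≤-antisym
  (ℕP.≤-pred (DivMod.m<n*o⇒m/o<n (subst (x + c <_) (ℕP.*-comm b (suc d)) x+c<b[1+d])))
  (subst (_≤ (x + c) / b) (DivMod.m*n/n≡m d b) (DivMod./-monoˡ-≤ b d*b≤x+c))
  where
  open ℕP.≤-Reasoning
  x+c<b[1+d] : x + c < b * suc d
  x+c<b[1+d] = begin-strict
    x + c      ≤⟨ ℕP.+-monoˡ-≤ c x≤bd ⟩
    b * d + c  <⟨ ℕP.+-monoʳ-< (b * d) (ℕP.n<1+n c) ⟩
    b * d + b  ≡⟨ ℕP.+-comm (b * d) b ⟩
    b + b * d  ≡⟨ ℕP.*-suc b d ⟨
    b * suc d  ∎
  d*b≤x+c : d * b ≤ x + c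
  d*b≤x+c = subst (_≤ x + c) (ℕP.*-comm b d) (ℕP.≤-pred (subst (b * d <_) (ℕP.+-suc x c) bd<x+b))

max'≡⊔ : ∀ m n → max' m n ≡ m ⊔ n
max'≡⊔ m n with m ≤ᵇ n | ℕP.≤ᵇ-reflects-≤ m n
... | true  | ofʸ m≤n = sym (ℕP.m≤n⇒m⊔n≡n m≤n)
... | false | ofⁿ m≰n = sym (ℕP.m≥n⇒m⊔n≡m (ℕP.<⇒≤ (ℕP.≰⇒> m≰n)))

foldr-max'-≥-seed : ∀ m ys → m ≤ foldr max' m ys
foldr-max'-≥-seed m [] = ℕP.≤-refl
foldr-max'-≥-seed m (y ∷ ys) = ℕP.≤-trans (foldr-max'-≥-seed m ys)
  (subst (foldr max' m ys ≤_) (sym (max'≡⊔ y _)) (ℕP.m≤n⊔m y _))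

foldr-max'-≥-elem : ∀ m {ys y} → y ∈ ys → y ≤ foldr max' m ys
foldr-max'-≥-elem m {y ∷ ys} (here refl) = subst (y ≤_) (sym (max'≡⊔ y _)) (ℕP.m≤m⊔n y _)
foldr-max'-≥-elem m {z ∷ ys} (there y∈) = ℕP.≤-trans (foldr-max'-≥-elem m y∈)
  (subst (foldr max' m ys ≤_) (sym (max'≡⊔ z _)) (ℕP.m≤n⊔m z _))

foldr-max'-attained : ∀ m ys → foldr max' m ys ≡ m ⊎ foldr max' m ys ∈ ys
foldr-max'-attained m [] = inj₁ refl
foldr-max'-attained m (y ∷ ys) with ℕP.⊔-sel y (foldr max' m ys)
... | inj₁ e = inj₂ (here (trans (max'≡⊔ y _) e))
... | inj₂ e with foldr-max'-attained m ys
...   | inj₁ e' = inj₁ (trans (max'≡⊔ y _) (trans e e'))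
...   | inj₂ e' = inj₂ (there (subst (_∈ ys) (sym (trans (max'≡⊔ y _) e)) e'))

-- Lattice paths

eastY≡sum : ∀ D k → eastY D k ≡ sum (applyUpTo (runLen D) k)
eastY≡sum D k = cong sum (LP.map-upTo (runLen D) k)

eastY-suc : ∀ D k → eastY D (suc k) ≡ eastY D k + runLen D k
eastY-suc D k = begin
  eastY D (suc k)                                          ≡⟨ eastY≡sum D (suc k) ⟩
  sum (applyUpTo (runLen D) (suc k))                       ≡⟨ cong sum (LP.applyUpTo-∷ʳ (runLen D) k) ⟨
  sum (applyUpTo (runLen D) k ∷ʳ runLen D k)               ≡⟨ sum-++ (applyUpTo (runLen D) k) _ ⟩
  sum (applyUpTo (runLen D) k) + (runLen D k + 0)          ≡⟨ cong₂ _+_ (eastY≡sum D k) (sym (ℕP.+-identityʳ _)) ⟨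
  eastY D k + runLen D k                                   ∎
  where open ≡-Reasoning

eastY-mono : ∀ D {p q} → p ≤ q → eastY D p ≤ eastY D q
eastY-mono D {q = zero} z≤n = ℕP.≤-refl
eastY-mono D {p} {suc q} p≤1+q with ℕP.m≤n⇒m<n∨m≡n p≤1+q
... | inj₂ refl  = ℕP.≤-refl
... | inj₁ p<1+q = ℕP.≤-trans (eastY-mono D (ℕP.≤-pred p<1+q))
                     (subst (eastY D q ≤_) (sym (eastY-suc D q)) (ℕP.m≤m+n (eastY D q) (runLen D q)))

eastY-E∷ : ∀ D k → eastY (E ∷ D) (suc k) ≡ eastY D k
eastY-E∷ D k = trans (eastY≡sum (E ∷ D) (suc k)) (sym (eastY≡sum D k))

eastY-N∷ : ∀ D k → eastY (N ∷ D) (suc k) ≡ suc (eastY D (suc k))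
eastY-N∷ D k = trans (eastY≡sum (N ∷ D) (suc k)) (cong suc (sym (eastY≡sum D (suc k))))

eastY-on-path : ∀ D {k} → k ≤ countE D → ∃[ t ] pt D t ≡ (k , eastY D k)
eastY-on-path D {zero} _ = 0 , refl
eastY-on-path (N ∷ D) {suc k} k≤ with eastY-on-path D k≤
... | t , e = suc t , trans (cong (map₂ suc) e) (cong (suc k ,_) (sym (eastY-N∷ D k)))
eastY-on-path (E ∷ D) {suc k} (s≤s k≤) with eastY-on-path D k≤
... | t , e = suc t , trans (cong (map₁ suc) e) (cong (suc k ,_) (sym (eastY-E∷ D k)))

countN≡eastY+runLen : ∀ D → countN D ≡ eastY D (countE D) + runLen D (countE D)
countN≡eastY+runLen [] = refl
countN≡eastY+runLen (N ∷ D) with countE D | countN≡eastY+runLen D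
... | zero  | e = cong suc e
... | suc c | e = trans (cong suc e) (cong (_+ runLen D (suc c)) (sym (eastY-N∷ D c)))
countN≡eastY+runLen (E ∷ D) =
  trans (countN≡eastY+runLen D) (cong (_+ runLen D (countE D)) (sym (eastY-E∷ D (countE D))))

Valley : List Step → ℕ → Set
Valley D p = 1 ≤ p × 1 ≤ runLen D p

valleyAt-sound : ∀ D t → isValleyAt (drop t D) ≡ true → ∃[ p ] pt D (suc t) ≡ (p , eastY D p) × Valley D p
valleyAt-sound (E ∷ N ∷ D) zero _ = 1 , refl , s≤s z≤n , s≤s z≤n
valleyAt-sound (N ∷ D) (suc t) v with valleyAt-sound D t v
... | suc p , e , V = suc p , trans (cong (map₂ suc) e) (cong (suc p ,_) (sym (eastY-N∷ D p))) , V
valleyAt-sound (E ∷ D) (suc t) v with valleyAt-sound D t v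
... | p , e , _ , r≥1 = suc p , trans (cong (map₁ suc) e) (cong (suc p ,_) (sym (eastY-E∷ D p))) , s≤s z≤n , r≥1

valleyAt-complete : ∀ D {p} → Valley D p →
  ∃[ t ] suc t ≤ length D × isValleyAt (drop t D) ≡ true × pt D (suc t) ≡ (p , eastY D p)
valleyAt-complete (N ∷ D) {suc p} V with valleyAt-complete D V
... | t , t< , v , e = suc t , s≤s t< , v , trans (cong (map₂ suc) e) (cong (suc p ,_) (sym (eastY-N∷ D p)))
valleyAt-complete (E ∷ N ∷ D) {suc zero} _ = 0 , s≤s z≤n , refl , refl
valleyAt-complete (E ∷ D) {suc (suc p)} (_ , r≥1) with valleyAt-complete D (s≤s z≤n , r≥1)
... | t , t< , v , e = suc t , s≤s t< , v , trans (cong (map₁ suc) e) (cong (suc (suc p) ,_) (sym (eastY-E∷ D (suc p))))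

fromRuns : (ℕ → ℕ) → ℕ → List Step
fromRuns f zero    = replicate (f 0) N
fromRuns f (suc n) = replicate (f 0) N ++ E ∷ fromRuns (f ∘ suc) n

path≡fromRuns : ∀ D → D ≡ fromRuns (runLen D) (countE D)
path≡fromRuns [] = refl
path≡fromRuns (N ∷ D) with countE D | path≡fromRuns D
... | zero  | e = cong (N ∷_) e
... | suc c | e = cong (N ∷_) e
path≡fromRuns (E ∷ D) = cong (E ∷_) (path≡fromRuns D)

word≡fromRuns : ∀ f n → f n ≡ 0 → f (suc n) ≡ 0 → word (applyUpTo f n) ≡ fromRuns f (suc n)
word≡fromRuns f zero fn≡0 f1+n≡0 rewrite fn≡0 | f1+n≡0 = refl
word≡fromRuns f (suc n) fn≡0 f1+n≡0 =
  cong (λ w → replicate (f 0) N ++ E ∷ w) (word≡fromRuns (f ∘ suc) n fn≡0 f1+n≡0)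

path≡word : ∀ D n → countE D ≡ suc n → runLen D n ≡ 0 → runLen D (suc n) ≡ 0 →
  D ≡ word (map (λ i → runLen D (i ∸ 1)) (range 0 n))
path≡word D n cE rn≡0 r1+n≡0 = begin
  D                                                 ≡⟨ path≡fromRuns D ⟩
  fromRuns (runLen D) (countE D)                    ≡⟨ cong (fromRuns (runLen D)) cE ⟩
  fromRuns (runLen D) (suc n)                       ≡⟨ word≡fromRuns (runLen D) n rn≡0 r1+n≡0 ⟨
  word (applyUpTo (runLen D) n)                     ≡⟨ cong word (LP.map-upTo (runLen D) n) ⟨
  word (map (runLen D) (upTo n))                    ≡⟨ cong word (LP.map-∘ (upTo n)) ⟩
  word (map (λ i → runLen D (i ∸ 1)) (range 0 n))   ∎
  where open ≡-Reasoning

-- Heights and lasers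

private
  pos-+-cancelʳ : ∀ m n k → + (m + k) ℤ.- (+ n ℤ.+ + k) ≡ + m ℤ.- + n
  pos-+-cancelʳ m n k = trans (cong (ℤ._- (+ n ℤ.+ + k)) (ℤP.pos-+ m k)) (cancel (+ m) (+ n) (+ k))
    where
    cancel : ∀ (i j k : ℤ) → (i ℤ.+ k) ℤ.- (j ℤ.+ k) ≡ i ℤ.- j
    cancel = solve-∀

  pos-+-cancelˡ : ∀ m n k → + (m + k) ℤ.- (+ k ℤ.+ + n) ≡ + m ℤ.- + n
  pos-+-cancelˡ m n k = trans (cong (λ z → + (m + k) ℤ.- z) (ℤP.+-comm (+ k) (+ n))) (pos-+-cancelʳ m n k)

-- aboveLaser compares b·y − a·x at two lattice points with both sides moved so that no subtraction occurs.
pos-sub-≤ : ∀ w x y z → w + z ≤ y + x → + w ℤ.- + x ℤ.≤ + y ℤ.- + z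
pos-sub-≤ w x y z le =
  subst₂ ℤ._≤_ (pos-+-cancelʳ w x z) (pos-+-cancelˡ y z x) (ℤP.+-monoˡ-≤ (ℤ.- (+ x ℤ.+ + z)) (+≤+ le))

pos-sub-< : ∀ w x y z → w + z < y + x → + w ℤ.- + x ℤ.< + y ℤ.- + z
pos-sub-< w x y z lt =
  subst₂ ℤ._<_ (pos-+-cancelʳ w x z) (pos-+-cancelˡ y z x) (ℤP.+-monoˡ-< (ℤ.- (+ x ℤ.+ + z)) (+<+ lt))

pos-sub-≤⁻ : ∀ w x y z → + w ℤ.- + x ℤ.≤ + y ℤ.- + z → w + z ≤ y + x
pos-sub-≤⁻ w x y z le = ℕP.≮⇒≥ (ℤP.≤⇒≯ le ∘ pos-sub-< y z w x)

pos-sub-<⁻ : ∀ w x y z → + w ℤ.- + x ℤ.< + y ℤ.- + z → w + z < y + x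
pos-sub-<⁻ w x y z lt = ℕP.≰⇒> (ℤP.<⇒≱ lt ∘ pos-sub-≤ y z w x)

module Lasers (a b : ℕ) (D : List Step) where

  private
    r : ℕ → ℕ
    r = runLen D

    y : ℕ → ℕ
    y = eastY D

  height : ℕ → ℤ
  height k = + (b * y k) ℤ.- + (a * k)

  height-suc : ∀ k → height (suc k) ≡ height k ℤ.+ (+ (b * r k) ℤ.- + a)
  height-suc k = begin
    + (b * y (suc k)) ℤ.- + (a * suc k)                 ≡⟨ cong₂ (λ u v → + u ℤ.- + v)
                                                            (trans (cong (b *_) (eastY-suc D k)) (ℕP.*-distribˡ-+ b (y k) (r k)))
                                                            (ℕP.*-suc a k) ⟩
    + (b * y k + b * r k) ℤ.- + (a + a * k)             ≡⟨ cong₂ ℤ._-_ (ℤP.pos-+ (b * y k) (b * r k)) (ℤP.pos-+ a (a * k)) ⟩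
    (+ (b * y k) ℤ.+ + (b * r k)) ℤ.- (+ a ℤ.+ + (a * k)) ≡⟨ regroup (+ (b * y k)) (+ (b * r k)) (+ a) (+ (a * k)) ⟩
    height k ℤ.+ (+ (b * r k) ℤ.- + a)                  ∎
    where
    open ≡-Reasoning
    regroup : ∀ (i j k l : ℤ) → (i ℤ.+ j) ℤ.- (k ℤ.+ l) ≡ (i ℤ.- l) ℤ.+ (j ℤ.- k)
    regroup = solve-∀

  height-flat : ∀ {k} → r k ≡ 0 → height k ≡ height (suc k) ℤ.+ + a
  height-flat {k} r≡0 = sym (begin
    height (suc k) ℤ.+ + a                        ≡⟨ cong (ℤ._+ + a) (height-suc k) ⟩
    (height k ℤ.+ (+ (b * r k) ℤ.- + a)) ℤ.+ + a  ≡⟨ cong (λ z → (height k ℤ.+ (+ z ℤ.- + a)) ℤ.+ + a)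
                                                      (trans (cong (b *_) r≡0) (ℕP.*-zeroʳ b)) ⟩
    (height k ℤ.+ (+ 0 ℤ.- + a)) ℤ.+ + a          ≡⟨ cancel (height k) (+ a) ⟩
    height k                                      ∎)
    where
    open ≡-Reasoning
    cancel : ∀ (i j : ℤ) → (i ℤ.+ (+ 0 ℤ.- j)) ℤ.+ j ≡ i
    cancel = solve-∀

  LaserBelow : ℕ → ℕ → Set
  LaserBelow p i = ∀ {k} → p < k → k ≤ i → height p ℤ.< height k

  Encloses : ℕ → ℕ → Set
  Encloses p i = p < i × LaserBelow p i

  laserBelow-restrict : ∀ {p i j} → LaserBelow p i → j ≤ i → LaserBelow p j
  laserBelow-restrict below j≤i p<k k≤j = below p<k (ℕP.≤-trans k≤j j≤i)

  laserBelow-extend : ∀ {p i} → LaserBelow p i → height p ℤ.< height (suc i) → LaserBelow p (suc i)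
  laserBelow-extend {i = i} below above {k} p<k k≤1+i with ℕP.m≤n⇒m<n∨m≡n k≤1+i
  ... | inj₁ k<1+i = below p<k (ℕP.≤-pred k<1+i)
  ... | inj₂ refl  = above

  aboveLaser⇒< : ∀ {p k} → aboveLaser a b (p , y p) k (y k) ≡ true → height p ℤ.< height k
  aboveLaser⇒< {p} {k} e = pos-sub-< (b * y p) (a * p) (b * y k) (a * k)
    (ℕP.<ᵇ⇒< _ _ (Equivalence.from T-≡ e))

  <⇒aboveLaser : ∀ {p k} → height p ℤ.< height k → aboveLaser a b (p , y p) k (y k) ≡ true
  <⇒aboveLaser {p} {k} lt = Equivalence.to T-≡ (ℕP.<⇒<ᵇ (pos-sub-<⁻ (b * y p) (a * p) (b * y k) (a * k) lt))

  enclosed⇒Encloses : ∀ {p i} → enclosed a b D (p , y p) i ≡ true → Encloses p i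
  enclosed⇒Encloses {p} {i} e with p <ᵇ i | ℕP.<ᵇ-reflects-< p i
  ... | true | ofʸ p<i = p<i , λ p<k k≤i →
    aboveLaser⇒< (all≡true⁻ (λ k → aboveLaser a b (p , y p) k (eastY D k)) (range p i) e (∈-range⁺ p<k k≤i))

  Encloses⇒enclosed : ∀ {p i} → Encloses p i → enclosed a b D (p , y p) i ≡ true
  Encloses⇒enclosed {p} {i} (p<i , below) with p <ᵇ i | ℕP.<ᵇ-reflects-< p i
  ... | true  | _        = all≡true⁺ (λ k → aboveLaser a b (p , y p) k (eastY D k)) (range p i)
    (λ k∈ → let p<k , k≤i = ∈-range⁻ k∈ in <⇒aboveLaser (below p<k k≤i))
  ... | false | ofⁿ p≮i = ⊥-elim (p≮i p<i)

  private
    sameSide⇒ : ∀ {i j} t → isValley D t ≡ true → sameSide a b D i j t ≡ true →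
      enclosed a b D (pt D t) i ≡ enclosed a b D (pt D t) j
    sameSide⇒ {i} {j} t v s with isValley D t | enclosed a b D (pt D t) i | enclosed a b D (pt D t) j
    sameSide⇒ t refl refl | true | true  | true  = refl
    sameSide⇒ t refl refl | true | false | false = refl

    sameSide⇐ : ∀ {i j} t → (isValley D t ≡ true → enclosed a b D (pt D t) i ≡ enclosed a b D (pt D t) j) →
      sameSide a b D i j t ≡ true
    sameSide⇐ {i} {j} t h with isValley D t | enclosed a b D (pt D t) i | enclosed a b D (pt D t) j
    ... | false | _     | _     = refl
    ... | true  | true  | true  = refl
    ... | true  | false | false = refl
    ... | true  | true  | false with () ← h refl
    ... | true  | false | true  with () ← h refl

    enclosed≡ : ∀ {p i j} → (Encloses p i → Encloses p j) → (Encloses p j → Encloses p i) →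
      enclosed a b D (p , y p) i ≡ enclosed a b D (p , y p) j
    enclosed≡ {p} {i} {j} i⇒j j⇒i with enclosed a b D (p , y p) i in ei | enclosed a b D (p , y p) j in ej
    ... | true  | true  = refl
    ... | false | false = refl
    ... | true  | false = ⊥-elim (not-¬ ej (Encloses⇒enclosed (i⇒j (enclosed⇒Encloses ei))))
    ... | false | true  = ⊥-elim (not-¬ ei (Encloses⇒enclosed (j⇒i (enclosed⇒Encloses ej))))

  sim⇒encloses : ∀ {i j} → sim a b D i j ≡ true → ∀ {p} → Valley D p → Encloses p i ⇔ Encloses p j
  sim⇒encloses {i} {j} s V with valleyAt-complete D V
  ... | t , t< , v , e = mk⇔ (λ enc → enclosed⇒Encloses (trans (sym enc≡) (Encloses⇒enclosed enc)))
                             (λ enc → enclosed⇒Encloses (trans enc≡ (Encloses⇒enclosed enc)))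
    where
    enc≡ = subst (λ P → enclosed a b D P i ≡ enclosed a b D P j) e
      (sameSide⇒ (suc t) v (all≡true⁻ (sameSide a b D i j) (range 0 (length D)) s (∈-range⁺ (s≤s z≤n) t<)))

  encloses⇒sim : ∀ {i j} → (∀ {p} → Valley D p → Encloses p i ⇔ Encloses p j) → sim a b D i j ≡ true
  encloses⇒sim {i} {j} i⇔j =
    all≡true⁺ (sameSide a b D i j) (range 0 (length D)) λ t∈ → step (proj₁ (∈-range⁻ t∈))
    where
    step : ∀ {t} → 0 < t → sameSide a b D i j t ≡ true
    step {suc t} _ = sameSide⇐ (suc t) λ v → let p , e , V = valleyAt-sound D t v in
      subst (λ P → enclosed a b D P i ≡ enclosed a b D P j) (sym e)
        (enclosed≡ (Equivalence.to (i⇔j V)) (Equivalence.from (i⇔j V)))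

  isMin⇒ : ∀ {m} → isMin a b D m ≡ true → ∀ {j} → 0 < j → j ≤ m ∸ 1 → sim a b D m j ≡ false
  isMin⇒ {m} e 0<j j≤ = any≡false⁻ (sim a b D m) (range 0 (m ∸ 1))
    (Equivalence.to T-not-≡ (Equivalence.from T-≡ e)) (∈-range⁺ 0<j j≤)

  isMin⇐ : ∀ {m} → (∀ {j} → 0 < j → j ≤ m ∸ 1 → sim a b D m j ≡ false) → isMin a b D m ≡ true
  isMin⇐ {m} h = Equivalence.to T-≡ (Equivalence.from T-not-≡
    (any≡false⁺ (sim a b D m) (range 0 (m ∸ 1)) (λ j∈ → let 0<j , j≤ = ∈-range⁻ j∈ in h 0<j j≤)))

  precBlk⇒ : ∀ {m′ m} → precBlk a b D m′ m ≡ true →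
    isMin a b D m′ ≡ true × m ≤ m′ × blkMax a b D m′ ≤ blkMax a b D m
  precBlk⇒ {m′} {m} e =
    let isMin′ , rest = Equivalence.to T-∧ (Equivalence.from T-≡ e)
        m≤m′ , max≤max = Equivalence.to (T-∧ {m ≤ᵇ m′}) rest
    in Equivalence.to T-≡ isMin′ , ℕP.≤ᵇ⇒≤ m m′ m≤m′ , ℕP.≤ᵇ⇒≤ _ _ max≤max

  precBlk⇐ : ∀ {m′ m} → isMin a b D m′ ≡ true → m ≤ m′ → blkMax a b D m′ ≤ blkMax a b D m →
    precBlk a b D m′ m ≡ true
  precBlk⇐ isMin′ m≤m′ max≤max = Equivalence.to T-≡ (Equivalence.from T-∧
    (Equivalence.from T-≡ isMin′ , Equivalence.from T-∧ (ℕP.≤⇒≤ᵇ m≤m′ , ℕP.≤⇒≤ᵇ max≤max)))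

-- Blocks of π(D) and their ranks

module DyckPath {a b : ℕ} (a<b : a < b) {D : List Step} (dyck : IsDyck a b D) where

  open Lasers a b D public

  private
    r : ℕ → ℕ
    r = runLen D

    y : ℕ → ℕ
    y = eastY D

    instance
      b≢0 : NonZero b
      b≢0 = >-nonZero (ℕP.≤-<-trans z≤n a<b)

  n₀ : ℕ
  n₀ = b ∸ 1

  1+n₀≡b : suc n₀ ≡ b
  1+n₀≡b = ℕP.suc-pred b

  n₀≤b : n₀ ≤ b
  n₀≤b = subst (n₀ ≤_) 1+n₀≡b (ℕP.n≤1+n n₀)

  <b⇒≤n₀ : ∀ {i} → i < b → i ≤ n₀
  <b⇒≤n₀ i<b = ℕP.≤-pred (subst (_ <_) (sym 1+n₀≡b) i<b)

  height-up : ∀ {k} → 1 ≤ r k → height k ℤ.< height (suc k)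
  height-up {k} r≥1 = subst₂ ℤ._<_ (ℤP.+-identityʳ (height k)) (sym (height-suc k))
    (ℤP.+-monoʳ-< (height k) (pos-sub-< 0 0 (b * r k) a (subst (a <_) (sym (ℕP.+-identityʳ (b * r k)))
      (ℕP.<-≤-trans a<b (ℕP.m≤m*n b (r k) {{>-nonZero r≥1}})))))

  height-descent⇒runLen≡0 : ∀ {k} → height (suc k) ℤ.≤ height k → r k ≡ 0
  height-descent⇒runLen≡0 {k} le with r k in e
  ... | zero  = refl
  ... | suc _ = ⊥-elim (ℤP.≤⇒≯ le (height-up (subst (1 ≤_) (sym e) (s≤s z≤n))))

  height-≤-pred : ∀ {k h} → height (suc k) ℤ.≤ h → height k ℤ.≤ h ℤ.+ + a
  height-≤-pred {k} {h} le with r k in e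
  ... | zero  = subst (ℤ._≤ h ℤ.+ + a) (sym (height-flat e)) (ℤP.+-monoˡ-≤ (+ a) le)
  ... | suc _ =
    ℤP.≤-trans (ℤP.<⇒≤ (ℤP.<-≤-trans (height-up (subst (1 ≤_) (sym e) (s≤s z≤n))) le)) (ℤP.i≤i+j h (+ a))

  private
    countE≡b : countE D ≡ b
    countE≡b = proj₁ (proj₂ dyck)

  below-diagonal : ∀ {k} → k ≤ b → a * k ≤ b * y k
  below-diagonal {k} k≤b with eastY-on-path D (subst (k ≤_) (sym countE≡b) k≤b)
  ... | t , e = subst₂ (λ u v → a * u ≤ b * v) (cong proj₁ e) (cong proj₂ e) (proj₂ (proj₂ dyck) t)

  height-nonneg : ∀ {k} → k ≤ b → + 0 ℤ.≤ height k
  height-nonneg {k} k≤b =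
    pos-sub-≤ 0 0 (b * y k) (a * k) (subst (a * k ≤_) (sym (ℕP.+-identityʳ _)) (below-diagonal k≤b))

  height-0 : height 0 ≡ + 0
  height-0 = cong₂ (λ u v → + u ℤ.- + v) (ℕP.*-zeroʳ b) (ℕP.*-zeroʳ a)

  private
    a≡y+r : a ≡ y b + r b
    a≡y+r = trans (sym (proj₁ dyck)) (subst (λ c → countN D ≡ y c + r c) countE≡b (countN≡eastY+runLen D))

    a≤y : a ≤ y b
    a≤y = ℕP.*-cancelˡ-≤ b (subst (_≤ b * y b) (ℕP.*-comm a b) (below-diagonal ℕP.≤-refl))

  runLen-b : r b ≡ 0
  runLen-b = ℕP.n≤0⇒n≡0 (ℕP.+-cancelˡ-≤ (y b) (r b) 0
    (subst₂ _≤_ a≡y+r (sym (ℕP.+-identityʳ (y b))) a≤y))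

  eastY-b : y b ≡ a
  eastY-b = sym (trans a≡y+r (trans (cong (λ z → y b + z) runLen-b) (ℕP.+-identityʳ (y b))))

  height-b : height b ≡ + 0
  height-b = trans (cong (λ z → + (b * z) ℤ.- + (a * b)) eastY-b)
                   (trans (cong (λ z → + z ℤ.- + (a * b)) (ℕP.*-comm b a)) (ℤP.+-inverseʳ (+ (a * b))))

  height-b≤ : ∀ {k} → k ≤ b → height b ℤ.≤ height k
  height-b≤ {k} k≤b = subst (ℤ._≤ height k) (sym height-b) (height-nonneg k≤b)

  runLen-n₀ : r n₀ ≡ 0
  runLen-n₀ = height-descent⇒runLen≡0 (subst (λ k → height k ℤ.≤ height n₀) (sym 1+n₀≡b) (height-b≤ n₀≤b))

  dyck≡word : D ≡ word (map (λ i → runLen D (i ∸ 1)) (range 0 n₀))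
  dyck≡word = path≡word D n₀ (trans countE≡b (sym 1+n₀≡b)) runLen-n₀ (subst (λ c → r c ≡ 0) (sym 1+n₀≡b) runLen-b)

  rise≡ceilDiv : ∀ {p q} → p ≤ q → height p ℤ.≤ height q → height q ℤ.≤ height p ℤ.+ + a →
    ceilDiv ((q ∸ p) * a) b ≡ y q ∸ y p
  rise≡ceilDiv {p} {q} p≤q lower upper with q ∸ p | ℕP.m+[n∸m]≡n p≤q
  ... | L | refl = ceilDiv-unique b (subst (_≤ b * d) (ℕP.*-comm a L) aL≤bd)
    (ℕP.≤-<-trans bd≤a+aL (subst (a + a * L <_) (trans (ℕP.+-comm b (a * L)) (cong (_+ b) (ℕP.*-comm a L)))
      (ℕP.+-monoˡ-< (a * L) a<b)))
    where
    d = y (p + L) ∸ y p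
    y≡ : y (p + L) ≡ y p + d
    y≡ = sym (ℕP.m+[n∸m]≡n (eastY-mono D (ℕP.m≤m+n p L)))
    regroup-x : ∀ b a y p L → b * y + a * (p + L) ≡ (b * y + a * p) + a * L
    regroup-x = ℕRing.solve-∀
    regroup-y : ∀ b a y p d → b * (y + d) + a * p ≡ (b * y + a * p) + b * d
    regroup-y = ℕRing.solve-∀
    regroup-upper : ∀ b a y p L → (b * y + a) + a * (p + L) ≡ (b * y + a * p) + (a + a * L)
    regroup-upper = ℕRing.solve-∀
    shift : ∀ m n k → (+ m ℤ.- + n) ℤ.+ + k ≡ + (m + k) ℤ.- + n
    shift m n k = trans (shift′ (+ m) (+ n) (+ k)) (cong (ℤ._- + n) (sym (ℤP.pos-+ m k)))
      where
      shift′ : ∀ (i j k : ℤ) → (i ℤ.- j) ℤ.+ k ≡ (i ℤ.+ k) ℤ.- j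
      shift′ = solve-∀
    aL≤bd : a * L ≤ b * d
    aL≤bd = ℕP.+-cancelˡ-≤ (b * y p + a * p) _ _
      (subst₂ _≤_ (regroup-x b a (y p) p L) (trans (cong (λ z → b * z + a * p) y≡) (regroup-y b a (y p) p d))
        (pos-sub-≤⁻ (b * y p) (a * p) (b * y (p + L)) (a * (p + L)) lower))
    bd≤a+aL : b * d ≤ a + a * L
    bd≤a+aL = ℕP.+-cancelˡ-≤ (b * y p + a * p) _ _
      (subst₂ _≤_ (trans (cong (λ z → b * z + a * p) y≡) (regroup-y b a (y p) p d)) (regroup-upper b a (y p) p L)
        (pos-sub-≤⁻ (b * y (p + L)) (a * (p + L)) (b * y p + a) (a * p)
          (subst (height (p + L) ℤ.≤_) (shift (b * y p) (a * p) a) upper)))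

  Root : ℕ → Set
  Root p = p ≡ 0 ⊎ Valley D p

  runLen-root : ∀ {k} → 1 ≤ r k → Root k
  runLen-root {zero}  _   = inj₁ refl
  runLen-root {suc k} r≥1 = inj₂ (s≤s z≤n , r≥1)

  -- p is the innermost valley whose laser encloses label i, or 0 if no laser does;
  -- the blocks of π(D) are the fibres of i ↦ p.
  Innermost : ℕ → ℕ → Set
  Innermost p i = (p ≡ 0 ⊎ (Valley D p × Encloses p i)) × (∀ {q} → Valley D q → p < q → ¬ Encloses q i)

  innermost-root : ∀ {p i} → Innermost p i → Root p
  innermost-root (inj₁ p≡0 , _)    = inj₁ p≡0
  innermost-root (inj₂ (V , _) , _) = inj₂ V

  innermost-< : ∀ {p i} → 0 < i → Innermost p i → p < i
  innermost-< 0<i (inj₁ refl , _)            = 0<i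
  innermost-< _   (inj₂ (_ , p<i , _) , _)   = p<i

  valleyEncloses? : ∀ q i → Dec (Valley D q × Encloses q i)
  valleyEncloses? q i = ((1 ℕP.≤? q) ×-dec (1 ℕP.≤? r q)) ×-dec
    map′ enclosed⇒Encloses Encloses⇒enclosed (enclosed a b D (q , y q) i Bool.≟ true)

  innermost-exists : ∀ i → ∃[ p ] Innermost p i
  innermost-exists i = search i (λ _ i<q (q<i , _) → ℕP.<-asym i<q q<i)
    where
    search : ∀ n → (∀ {q} → Valley D q → n < q → ¬ Encloses q i) → ∃[ p ] Innermost p i
    search zero    outer = 0 , inj₁ refl , outer
    search (suc n) outer with valleyEncloses? (suc n) i
    ... | yes VE  = suc n , inj₂ VE , outer
    ... | no ¬VE = search n λ {q} V n<q enc → case ℕP.m≤n⇒m<n∨m≡n n<q of λ where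
      (inj₁ 1+n<q) → outer V 1+n<q enc
      (inj₂ refl)  → ¬VE (V , enc)

  innermost-valley : ∀ {p i} → Innermost p i → 0 < p → Valley D p × Encloses p i
  innermost-valley (inj₁ refl , _) ()
  innermost-valley (inj₂ VE , _) _ = VE

  innermost-≥ : ∀ {p i q} → Innermost p i → Valley D q → Encloses q i → q ≤ p
  innermost-≥ (_ , outer) V enc = ℕP.≮⇒≥ (λ p<q → outer V p<q enc)

  innermost-transfer : ∀ {p i j q} → Innermost p i → Innermost p j → Valley D q → Encloses q i → Encloses q j
  innermost-transfer {p} {i} {j} {q} ti tj V (q<i , below-i) with ℕP.m≤n⇒m<n∨m≡n (innermost-≥ ti V (q<i , below-i))
  ... | inj₂ refl = proj₂ (innermost-valley tj (proj₁ V))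
  ... | inj₁ q<p  = ℕP.<-trans q<p p<j , below
    where
    0<p = ℕP.≤-<-trans z≤n q<p
    p<i = proj₁ (proj₂ (innermost-valley ti 0<p))
    p<j = proj₁ (proj₂ (innermost-valley tj 0<p))
    below-j = proj₂ (proj₂ (innermost-valley tj 0<p))
    below : LaserBelow q j
    below {k} q<k k≤j with k ℕP.≤? p
    ... | yes k≤p = below-i q<k (ℕP.≤-trans k≤p (ℕP.<⇒≤ p<i))
    ... | no  k≰p = ℤP.<-trans (below-i q<p (ℕP.<⇒≤ p<i)) (below-j (ℕP.≰⇒> k≰p) k≤j)

  innermost⇒sim : ∀ {p i j} → Innermost p i → Innermost p j → sim a b D i j ≡ true
  innermost⇒sim ti tj = encloses⇒sim (λ V → mk⇔ (innermost-transfer ti tj V) (innermost-transfer tj ti V))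

  sim⇒innermost≡ : ∀ {i j p p′} → sim a b D i j ≡ true → Innermost p i → Innermost p′ j → p ≡ p′
  sim⇒innermost≡ s ti tj = ℕP.≤-antisym (outer tj ti (Equivalence.to ∘ sim⇒encloses s))
                                         (outer ti tj (Equivalence.from ∘ sim⇒encloses s))
    where
    outer : ∀ {i j p p′} → Innermost p i → Innermost p′ j →
      (∀ {q} → Valley D q → Encloses q j → Encloses q i) → p′ ≤ p
    outer ti (inj₁ refl , _)        _   = z≤n
    outer ti (inj₂ (V , enc) , _) j⇒i = innermost-≥ ti V (j⇒i V enc)

  sim-refl : ∀ i → sim a b D i i ≡ true
  sim-refl i = let _ , ti = innermost-exists i in innermost⇒sim ti ti

  innermost-suc : ∀ {p} → Root p → Innermost p (suc p)
  innermost-suc (inj₁ refl) = inj₁ refl , λ V _ (q<1 , _) → ℕP.<-irrefl refl (ℕP.<-≤-trans q<1 (proj₁ V))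
  innermost-suc {p} (inj₂ V) =
    inj₂ (V , ℕP.n<1+n p , below) , λ _ p<q (q<1+p , _) → ℕP.<⇒≱ p<q (ℕP.≤-pred q<1+p)
    where
    below : LaserBelow p (suc p)
    below p<k k≤1+p with ℕP.≤-antisym k≤1+p p<k
    ... | refl = height-up (proj₂ V)

  root⇒isMin : ∀ {p} → Root p → isMin a b D (suc p) ≡ true
  root⇒isMin {p} root = isMin⇐ {suc p} λ {j} 0<j j≤p → ¬-not λ s →
    let p′ , tj = innermost-exists j
    in ℕP.<⇒≱ (innermost-< 0<j tj) (subst (j ≤_) (sim⇒innermost≡ s (innermost-suc root) tj) j≤p)

  isMin⇒root : ∀ {p} → isMin a b D (suc p) ≡ true → Root p
  isMin⇒root {p} isMin′ with innermost-exists (suc p)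
  ... | p′ , t with ℕP.m≤n⇒m<n∨m≡n (ℕP.≤-pred (innermost-< (s≤s z≤n) t))
  ...   | inj₂ refl = innermost-root t
  ...   | inj₁ p′<p =
    ⊥-elim (not-¬ (isMin⇒ {suc p} isMin′ (s≤s z≤n) p′<p) (innermost⇒sim t (innermost-suc (innermost-root t))))

  private
    blockLabel : ℕ → ℕ → ℕ
    blockLabel m j = if sim a b D m j then j else 0

  blkMax-≥ : ∀ m → m ≤ blkMax a b D m
  blkMax-≥ m = foldr-max'-≥-seed m (map (blockLabel m) (range 0 n₀))

  blkMax-maximal : ∀ {m j} → 0 < j → j ≤ n₀ → sim a b D m j ≡ true → j ≤ blkMax a b D m
  blkMax-maximal {m} {j} 0<j j≤n₀ s = subst (_≤ blkMax a b D m) (cong (if_then j else 0) s)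
    (foldr-max'-≥-elem m (∈-map⁺ (blockLabel m) (∈-range⁺ 0<j j≤n₀)))

  blkMax-attained : ∀ {m} → 0 < m → m ≤ n₀ → blkMax a b D m ≤ n₀ × sim a b D m (blkMax a b D m) ≡ true
  blkMax-attained {m} 0<m m≤n₀ with foldr-max'-attained m (map (blockLabel m) (range 0 n₀))
  ... | inj₁ M≡m = subst (λ M → M ≤ n₀ × sim a b D m M ≡ true) (sym M≡m) (m≤n₀ , sim-refl m)
  ... | inj₂ M∈ with ∈-map⁻ (blockLabel m) M∈
  ...   | j , j∈ , M≡fj with sim a b D m j in s
  ...     | true  = subst (λ M → M ≤ n₀ × sim a b D m M ≡ true) (sym M≡fj) (proj₂ (∈-range⁻ {0} {n₀} j∈) , s)
  ...     | false = ⊥-elim (ℕP.<⇒≱ 0<m (subst (m ≤_) M≡fj (blkMax-≥ m)))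

  innermost-blkMax : ∀ {p} → Root p → suc p ≤ n₀ → Innermost p (blkMax a b D (suc p))
  innermost-blkMax {p} root 1+p≤n₀ =
    let p′ , t = innermost-exists (blkMax a b D (suc p))
        s = proj₂ (blkMax-attained (s≤s z≤n) 1+p≤n₀)
    in subst (λ q → Innermost q _) (sym (sim⇒innermost≡ s (innermost-suc root) t)) t

  innermost⇒≤blkMax : ∀ {p j} → Root p → Innermost p j → 0 < j → j ≤ n₀ → j ≤ blkMax a b D (suc p)
  innermost⇒≤blkMax root tj 0<j j≤n₀ = blkMax-maximal 0<j j≤n₀ (innermost⇒sim (innermost-suc root) tj)

  module Block {p : ℕ} (root : Root p) (1+p≤n₀ : suc p ≤ n₀) where

    M : ℕ
    M = blkMax a b D (suc p)

    innermost-M : Innermost p M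
    innermost-M = innermost-blkMax root 1+p≤n₀

    p<M : p < M
    p<M = blkMax-≥ (suc p)

    M≤n₀ : M ≤ n₀
    M≤n₀ = proj₁ (blkMax-attained (s≤s z≤n) 1+p≤n₀)

    below-M : Valley D p → LaserBelow p M
    below-M V = proj₂ (proj₂ (innermost-valley innermost-M (proj₁ V)))

    height-lower : height p ℤ.≤ height M
    height-lower = lower root
      where
      lower : Root p → height p ℤ.≤ height M
      lower (inj₁ refl) = subst (ℤ._≤ height M) (sym height-0) (height-nonneg (ℕP.≤-trans M≤n₀ n₀≤b))
      lower (inj₂ V)    = ℤP.<⇒≤ (below-M V p<M ℕP.≤-refl)

    height-M≤ : ∀ {k} → M ≤ k → LaserBelow M k → height M ℤ.≤ height k
    height-M≤ M≤k below with ℕP.m≤n⇒m<n∨m≡n M≤k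
    ... | inj₁ M<k  = ℤP.<⇒≤ (below M<k ℕP.≤-refl)
    ... | inj₂ refl = ℤP.≤-refl

    escapes : ∀ {k} → M ≤ k → LaserBelow M k → (Valley D p → LaserBelow p (suc k)) →
      height (suc k) ℤ.≤ height M → Innermost p (suc k)
    escapes {k} M≤k below-M-k below-p low = cover root , outer
      where
      cover : Root p → p ≡ 0 ⊎ (Valley D p × Encloses p (suc k))
      cover (inj₁ p≡0) = inj₁ p≡0
      cover (inj₂ V)   = inj₂ (V , ℕP.<-≤-trans p<M (ℕP.m≤n⇒m≤1+n M≤k) , below-p V)
      outer : ∀ {q} → Valley D q → p < q → ¬ Encloses q (suc k)
      outer {q} V p<q (q<1+k , below-q) with ℕP.<-cmp q M
      ... | tri< q<M _ _  = proj₂ innermost-M V p<q (q<M , laserBelow-restrict below-q (ℕP.m≤n⇒m≤1+n M≤k))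
      ... | tri≈ _ refl _ = ℤP.<⇒≱ (below-q q<1+k ℕP.≤-refl) low
      ... | tri> _ _ M<q  = ℤP.<⇒≱ (ℤP.<-trans (below-M-k M<q (ℕP.≤-pred q<1+k)) (below-q q<1+k ℕP.≤-refl)) low

    -- Walk right from M while the path stays above the lasers from p and from M. A label reached
    -- at height ≤ height M would lie in the block of p beyond its maximum, so the walk stops only
    -- where the next label has height ≤ height p; one east step lowers the height by at most a.
    climb : ∀ d {k} → d + k ≡ n₀ → M ≤ k → LaserBelow M k → (Valley D p → LaserBelow p k) →
      height M ℤ.≤ height p ℤ.+ + a
    climb zero {k} k≡n₀ M≤k below-M-k _ = ℤP.≤-trans (height-M≤ M≤k below-M-k) (height-≤-pred
      (subst (λ j → height j ℤ.≤ height p) (sym (trans (cong suc k≡n₀) 1+n₀≡b))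
        (height-b≤ (ℕP.<⇒≤ (ℕP.<-≤-trans p<M (ℕP.≤-trans M≤n₀ n₀≤b))))))
    climb (suc d) {k} d+k≡n₀ M≤k below-M-k below-p with height (suc k) ℤ.≤? height p
    ... | yes drop = ℤP.≤-trans (height-M≤ M≤k below-M-k) (height-≤-pred drop)
    ... | no rise with height M ℤ.<? height (suc k)
    ...   | yes up  = climb d (trans (ℕP.+-suc d k) d+k≡n₀) (ℕP.m≤n⇒m≤1+n M≤k)
                        (laserBelow-extend below-M-k up) (λ V → laserBelow-extend (below-p V) (ℤP.≰⇒> rise))
    ...   | no ¬up = ⊥-elim (ℕP.<⇒≱ (innermost⇒≤blkMax root joins (s≤s z≤n) 1+k≤n₀) M≤k)
      where
      joins = escapes M≤k below-M-k (λ V → laserBelow-extend (below-p V) (ℤP.≰⇒> rise)) (ℤP.≮⇒≥ ¬up)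
      1+k≤n₀ = subst (suc k ≤_) d+k≡n₀ (s≤s (ℕP.m≤n+m k d))

    height-upper : height M ℤ.≤ height p ℤ.+ + a
    height-upper = climb (n₀ ∸ M) (ℕP.m∸n+n≡m M≤n₀) ℕP.≤-refl (λ M<k k≤M → ⊥-elim (ℕP.<⇒≱ M<k k≤M)) below-M

    nested : ∀ {q} → Valley D q → p < q → q < M → blkMax a b D (suc q) ≤ M
    nested V p<q q<M = ℕP.≮⇒≥ λ M<M′ →
      let _ , _ , below-q = innermost-valley (innermost-blkMax (inj₂ V) (ℕP.≤-trans q<M M≤n₀)) (proj₁ V)
      in proj₂ innermost-M V p<q (q<M , laserBelow-restrict below-q (ℕP.<⇒≤ M<M′))

    -- the summands of the rank equation of the block of p + 1, with runLen D (m′ ∸ 1) as the rank of block m′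
    contribution : ℕ → ℤ
    contribution m′ = if precBlk a b D m′ (suc p) then + runLen D (m′ ∸ 1) else + 0

    contribution-inside : ∀ {k} → p ≤ k → k < M → contribution (suc k) ≡ + runLen D k
    contribution-inside {k} p≤k k<M with precBlk a b D (suc k) (suc p) in e
    ... | true  = refl
    ... | false with runLen D k in rk
    ...   | zero  = refl
    ...   | suc _ = ⊥-elim (not-¬ e (precBlk⇐ {suc k} {suc p} (root⇒isMin (runLen-root r≥1)) (s≤s p≤k) inner))
      where
      r≥1 : 1 ≤ runLen D k
      r≥1 = subst (1 ≤_) (sym rk) (s≤s z≤n)
      inner : blkMax a b D (suc k) ≤ M
      inner with ℕP.m≤n⇒m<n∨m≡n p≤k
      ... | inj₂ refl = ℕP.≤-refl
      ... | inj₁ p<k  = nested (ℕP.≤-<-trans z≤n p<k , r≥1) p<k k<M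

    contribution-outside : ∀ {k} → k < p ⊎ M ≤ k → contribution (suc k) ≡ + 0
    contribution-outside {k} out with precBlk a b D (suc k) (suc p) in e
    ... | false = refl
    ... | true  with precBlk⇒ {suc k} {suc p} e | out
    ...   | _ , 1+p≤1+k , _  | inj₁ k<p = ⊥-elim (ℕP.<⇒≱ k<p (ℕP.≤-pred 1+p≤1+k))
    ...   | _ , _ , max≤M    | inj₂ M≤k = ⊥-elim (ℕP.<⇒≱ (ℕP.≤-trans (blkMax-≥ (suc k)) max≤M) M≤k)

    -- the contributions telescope against eastY D ∘ clip
    clip : ℕ → ℕ
    clip k = p ⊔ (k ⊓ M)

    clip-below : ∀ {k} → k ≤ p → clip k ≡ p
    clip-below {k} k≤p = ℕP.m≥n⇒m⊔n≡m (ℕP.≤-trans (ℕP.m⊓n≤m k M) k≤p)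

    clip-inside : ∀ {k} → p ≤ k → k ≤ M → clip k ≡ k
    clip-inside p≤k k≤M = trans (cong (p ⊔_) (ℕP.m≤n⇒m⊓n≡m k≤M)) (ℕP.m≤n⇒m⊔n≡n p≤k)

    clip-above : ∀ {k} → M ≤ k → clip k ≡ M
    clip-above M≤k = trans (cong (p ⊔_) (ℕP.m≥n⇒m⊓n≡n M≤k)) (ℕP.m≤n⇒m⊔n≡n (ℕP.<⇒≤ p<M))

    telescope-flat : ∀ {k c} → clip k ≡ c → clip (suc k) ≡ c → contribution (suc k) ≡ + 0 →
      + y (clip k) ℤ.+ contribution (suc k) ≡ + y (clip (suc k))
    telescope-flat e e′ c≡0 =
      trans (cong₂ (λ u v → + y u ℤ.+ v) e c≡0) (trans (ℤP.+-identityʳ _) (cong (λ u → + y u) (sym e′)))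

    telescope-step : ∀ k → + y (clip k) ℤ.+ contribution (suc k) ≡ + y (clip (suc k))
    telescope-step k with suc k ℕP.≤? p | M ℕP.≤? k
    ... | yes 1+k≤p | _       =
      telescope-flat (clip-below (ℕP.<⇒≤ 1+k≤p)) (clip-below 1+k≤p) (contribution-outside (inj₁ 1+k≤p))
    ... | no _      | yes M≤k =
      telescope-flat (clip-above M≤k) (clip-above (ℕP.m≤n⇒m≤1+n M≤k)) (contribution-outside (inj₂ M≤k))
    ... | no 1+k≰p  | no M≰k  = begin
      + y (clip k) ℤ.+ contribution (suc k)   ≡⟨ cong₂ (λ u v → + y u ℤ.+ v) (clip-inside p≤k (ℕP.<⇒≤ k<M))
                                                       (contribution-inside p≤k k<M) ⟩
      + y k ℤ.+ + runLen D k                  ≡⟨ ℤP.pos-+ (y k) (runLen D k) ⟨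
      + (y k + runLen D k)                    ≡⟨ cong +_ (eastY-suc D k) ⟨
      + y (suc k)                             ≡⟨ cong (λ u → + y u) (clip-inside (ℕP.m≤n⇒m≤1+n p≤k) k<M) ⟨
      + y (clip (suc k))                      ∎
      where
      open ≡-Reasoning
      p≤k = ℕP.≤-pred (ℕP.≰⇒> 1+k≰p)
      k<M = ℕP.≰⇒> M≰k

    rank-sum : sumℤ (map contribution (range 0 n₀)) ≡ + (y M ∸ y p)
    rank-sum = +-cancelˡ (+ y p) _ _ (begin
      + y p ℤ.+ Σ               ≡⟨ cong (λ u → + y u ℤ.+ Σ) (clip-below z≤n) ⟨
      + y (clip 0) ℤ.+ Σ        ≡⟨ sumℤ-telescope (λ k → + y (clip k)) contribution n₀ (λ k _ → telescope-step k) ⟩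
      + y (clip n₀)             ≡⟨ cong (λ u → + y u) (clip-above M≤n₀) ⟩
      + y M                     ≡⟨ cong +_ (ℕP.m+[n∸m]≡n (eastY-mono D (ℕP.<⇒≤ p<M))) ⟨
      + (y p + (y M ∸ y p))     ≡⟨ ℤP.pos-+ (y p) _ ⟩
      + y p ℤ.+ + (y M ∸ y p)   ∎)
      where
      open ≡-Reasoning
      Σ = sumℤ (map contribution (range 0 n₀))

    rank-equation : sumℤ (map contribution (range 0 (b ∸ 1))) ≡ + ceilDiv ((M ∸ suc p + 1) * a) b
    rank-equation = trans rank-sum (cong +_ (sym (trans (cong (λ L → ceilDiv (L * a) b) width)
      (rise≡ceilDiv (ℕP.<⇒≤ p<M) height-lower height-upper))))
      where
      width : M ∸ suc p + 1 ≡ M ∸ p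
      width = trans (ℕP.+-comm (M ∸ suc p) 1) (sym (ℕP.+-∸-assoc 1 p<M))

  rank-unique : ∀ rk → IsRank a b D rk →
    ∀ {m} → 0 < m → m ≤ n₀ → isMin a b D m ≡ true → rk m ≡ + runLen D (m ∸ 1)
  rank-unique rk isRank {m} = go (suc (blkMax a b D m ∸ m)) (ℕP.n<1+n _)
    where
    select : ∀ {c : Bool} {x y} → c ≡ true → (if c then x else + 0) ≡ (if c then y else + 0) → x ≡ y
    select refl x≡y = x≡y

    -- Strong induction on the block width: besides the block itself, its rank equation only
    -- involves blocks nested in it.
    go : ∀ s {m} → blkMax a b D m ∸ m < s →
      0 < m → m ≤ n₀ → isMin a b D m ≡ true → rk m ≡ + runLen D (m ∸ 1)
    go (suc s) {m@(suc p)} width< 0<m m≤n₀ isMin′ = select (precBlk⇐ {m} {m} isMin′ ℕP.≤-refl ℕP.≤-refl)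
      (sumℤ-agree-except F contribution n₀ 0<m m≤n₀ agree
        (trans (isRank m 0<m (subst (m <_) 1+n₀≡b (s≤s m≤n₀)) isMin′) (sym rank-equation)))
      where
      open Block (isMin⇒root isMin′) m≤n₀
      F : ℕ → ℤ
      F m′ = if precBlk a b D m′ m then rk m′ else + 0
      agree : ∀ {k} → 0 < k → k ≤ n₀ → k ≢ m → F k ≡ contribution k
      agree {k} 0<k k≤n₀ k≢m with precBlk a b D k m in e
      ... | false = refl
      ... | true  = go s narrower 0<k k≤n₀ isMin-k
        where
        isMin-k = proj₁ (precBlk⇒ {k} {m} e)
        m≤k = proj₁ (proj₂ (precBlk⇒ {k} {m} e))
        max≤ = proj₂ (proj₂ (precBlk⇒ {k} {m} e))
        narrower : blkMax a b D k ∸ k < s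
        narrower = ℕP.<-≤-trans (ℕP.≤-<-trans (ℕP.∸-monoˡ-≤ k max≤)
                     (ℕP.∸-monoʳ-< (ℕP.≤∧≢⇒< m≤k (k≢m ∘ sym)) (ℕP.≤-trans (blkMax-≥ k) max≤)))
                     (ℕP.≤-pred width<)

  rankSeq≡runLen : ∀ rk → IsRank a b D rk →
    ∀ {i} → 0 < i → i ≤ n₀ → rankSeq a b D rk i ≡ + runLen D (i ∸ 1)
  rankSeq≡runLen rk isRank {suc k} 0<i i≤n₀ with isMin a b D (suc k) in e
  ... | true  = rank-unique rk isRank 0<i i≤n₀ e
  ... | false with runLen D k in rk≡
  ...   | zero  = refl
  ...   | suc _ = ⊥-elim (not-¬ e (root⇒isMin (runLen-root (subst (1 ≤_) (sym rk≡) (s≤s z≤n)))))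

proposition3p8 : (a b : ℕ) → 0 < a → a < b → Coprime a b →
    (D : List Step) → IsDyck a b D →
    (rk : ℕ → ℤ) → IsRank a b D rk →
      (∀ m → 1 ≤ m → m < b → isMin a b D m ≡ true →
        + runLen D (m ∸ 1) ≡ rk m)
      × ((∀ i → 1 ≤ i → i < b → + 0 ℤ.≤ rankSeq a b D rk i)
        × D ≡ word (map (λ i → ∣ rankSeq a b D rk i ∣) (range 0 (b ∸ 1))))
proposition3p8 a b _ a<b _ D dyck rk isRank = runs , nonneg , path
  where
  open DyckPath a<b dyck
  runs : ∀ m → 1 ≤ m → m < b → isMin a b D m ≡ true → + runLen D (m ∸ 1) ≡ rk m
  runs m 0<m m<b isMin′ = sym (rank-unique rk isRank 0<m (<b⇒≤n₀ m<b) isMin′)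
  nonneg : ∀ i → 1 ≤ i → i < b → + 0 ℤ.≤ rankSeq a b D rk i
  nonneg i 0<i i<b = subst (+ 0 ℤ.≤_) (sym (rankSeq≡runLen rk isRank 0<i (<b⇒≤n₀ i<b))) (+≤+ z≤n)
  path : D ≡ word (map (λ i → ∣ rankSeq a b D rk i ∣) (range 0 (b ∸ 1)))
  path = trans dyck≡word (cong word (map-cong-range _ _ λ 0<i i≤n₀ → sym (cong ∣_∣ (rankSeq≡runLen rk isRank 0<i i≤n₀))))
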